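{- Fix $k\ge 2$ and write $A_xy=A_x(k,y)$. Suppose $m>0$ has $k$-sandwiching sequence $(a_i,b_i)_{i=1}^n$ with sandwiching values $m_0,\dots,m_n$, and let $w$ be a natural number and $1\le j\le n$ be such that $A_{a_j}b_j\le w<A_{a_j}(b_j+1)$. Then $(a_i,b_i)_{i=1}^j$ is an initial segment of the $k$-sandwiching sequence of $w$. If moreover $A_0m_j>w$, then $(a_i,b_i)_{i=1}^j$ is the full $k$-sandwiching sequence of $w$, and hence $w\equiv_k A_{a_j}b_j+c$ for a suitable $c$.
   Context: Ackermann function: for $k\ge 2$, $a,b\ge 0$: $A_a(k,-1):=1$, $A_0(k,b):=k^b$, $A_{a+1}(k,b):=A_a(k,\cdot)^k(A_{a+1}(k,b-1))$, with $f^j$ the $j$-fold iterate. $k$-normal form and sandwiching: for $m>0$ and naturals $a,b,c$, $m\equiv_k A_ab+c$ means $m=A_ab+c$ and there exist $n\ge1$ and naturals $a_1,\dots,a_n$ (sandwiching indices), $b_1,\dots,b_n$ (sandwiching arguments), $m_0,\dots,m_n$ (sandwiching values) with $m_0=0$; for $0\le i<n$: $A_{a_{i+1}}m_i\le m<A_{a_{i+1}+1}m_i$, $A_{a_{i+1}}b_{i+1}\le m<A_{a_{i+1}}(b_{i+1}+1)$, $m_{i+1}=A_{a_{i+1}}b_{i+1}$; $A_0m_n>m$; $a=a_n$, $b=b_n$. The sequence of pairs $(a_i,b_i)_{i=1}^n$ is the $k$-sandwiching sequence of $m$; it is uniquely determined by $m$. The number $0$ has empty sandwiching sequence and normal form $0$.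 -}

module Defs where

open import Data.Nat using (ℕ; zero; suc; _+_; _^_; _≤_; _<_; _>_)
open import Data.Product using (Σ; _×_; ∃)
open import Relation.Binary.PropositionalEquality using (_≡_)

iter : (ℕ → ℕ) → ℕ → ℕ → ℕ
iter f zero    x = x
iter f (suc j) x = f (iter f j x)

-- Ack k a b = A_a(k,b) for b ≥ 0.  The clause A_a(k,-1) = 1 is built in:
-- A_{a+1}(k,0) = A_a(k,·)^k (A_{a+1}(k,-1)) = A_a(k,·)^k 1.
Ack : ℕ → ℕ → ℕ → ℕ
Ack k zero    b       = k ^ b
Ack k (suc a) zero    = iter (Ack k a) k 1
Ack k (suc a) (suc b) = iter (Ack k a) k (Ack k (suc a) b)

-- IsSandwiching k m n as bs ms : (as i , bs i)_{i=1}^n is a k-sandwiching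
-- sequence of m with sandwiching values ms 0 , … , ms n.
-- (Sequences are functions ℕ → ℕ; only indices 1..n of as, bs and 0..n of ms matter.)
IsSandwiching : ℕ → ℕ → ℕ → (ℕ → ℕ) → (ℕ → ℕ) → (ℕ → ℕ) → Set
IsSandwiching k m n as bs ms =
  1 ≤ n × ms 0 ≡ 0 ×
  (∀ i → i < n →
     (Ack k (as (suc i)) (ms i) ≤ m × m < Ack k (suc (as (suc i))) (ms i)) ×
     (Ack k (as (suc i)) (bs (suc i)) ≤ m × m < Ack k (as (suc i)) (suc (bs (suc i)))) ×
     ms (suc i) ≡ Ack k (as (suc i)) (bs (suc i))) ×
  Ack k 0 (ms n) > m

NormalForm : ℕ → ℕ → ℕ → ℕ → ℕ → Set
NormalForm k m a b c =
  m ≡ Ack k a b + c ×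
  Σ ℕ λ n → Σ (ℕ → ℕ) λ as → Σ (ℕ → ℕ) λ bs → Σ (ℕ → ℕ) λ ms →
    IsSandwiching k m n as bs ms × as n ≡ a × bs n ≡ b

-- A step of a sandwiching of m from the value m_i, with index a and argument b, remains a
-- step for every w in its window A_a b ≤ w < A_a (b + 1). Consecutive windows are nested:
-- the indices strictly decrease and A_a (b + 1) is a value of every lower A_{a′}. So if w
-- lies in the j-th window of m, the first j steps of m are steps of w. Index and argument of
-- a step are unique brackets of monotone functions, so every sandwiching sequence of w starts
-- with these steps; continuing greedily yields one, since sandwiching values strictly
-- increase and stay below w.

module Submission where

open import Defs
open import Data.Nat
  using ( ℕ; zero; suc; pred; _+_; _∸_; _^_; _≤_; _<_; _>_; z≤n; s≤s; s≤s⁻¹; _≤?_; _≟_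
        ; _≤′_; ≤′-refl; ≤′-step)
open import Data.Nat.Properties
open import Data.Product using (Σ; ∃-syntax; _×_; _,_)
open import Data.Empty using (⊥-elim)
open import Data.Sum using (inj₁; inj₂)
open import Relation.Binary.Definitions using (Monotonic₁)
open import Relation.Nullary using (yes; no)
open import Relation.Binary.PropositionalEquality using (_≡_; _≢_; refl; sym; trans; subst)

step⇒mono-≤ : (f : ℕ → ℕ) → (∀ n → f n ≤ f (suc n)) → Monotonic₁ _≤_ _≤_ f
step⇒mono-≤ f step m≤n = go (≤⇒≤′ m≤n)
  where
    go : ∀ {m n} → m ≤′ n → f m ≤ f n
    go ≤′-refl = ≤-refl
    go (≤′-step m≤′n) = ≤-trans (go m≤′n) (step _)

step⇒mono-< : (f : ℕ → ℕ) → (∀ n → f n < f (suc n)) → Monotonic₁ _<_ _<_ f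
step⇒mono-< f step m<n = go (≤⇒≤′ m<n)
  where
    go : ∀ {m n} → suc m ≤′ n → f m < f n
    go ≤′-refl = step _
    go (≤′-step m<′n) = <-trans (go m<′n) (step _)

mono-≤-reflects-< : (f : ℕ → ℕ) → Monotonic₁ _≤_ _≤_ f → ∀ {m n} → f m < f n → m < n
mono-≤-reflects-< f mono fm<fn = ≰⇒> (λ n≤m → <⇒≱ fm<fn (mono n≤m))

bracket-unique : (f : ℕ → ℕ) → Monotonic₁ _≤_ _≤_ f → ∀ {w} a a′ →
  f a ≤ w → w < f (suc a) → f a′ ≤ w → w < f (suc a′) → a ≡ a′
bracket-unique f mono a a′ l u l′ u′ =
  ≤-antisym (s≤s⁻¹ (mono-≤-reflects-< f mono (≤-<-trans l u′)))
            (s≤s⁻¹ (mono-≤-reflects-< f mono (≤-<-trans l′ u)))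

bracket-exists : (f : ℕ → ℕ) → ∀ {s N w} → s ≤ N → f s ≤ w → w < f N →
  ∃[ a ] f a ≤ w × w < f (suc a)
bracket-exists f s≤N = go (≤⇒≤′ s≤N)
  where
    go : ∀ {s N w} → s ≤′ N → f s ≤ w → w < f N → ∃[ a ] f a ≤ w × w < f (suc a)
    go ≤′-refl fs≤w w<fs = ⊥-elim (<⇒≱ w<fs fs≤w)
    go {w = w} (≤′-step {N} s≤′N) fs≤w w<f1+N with f N ≤? w
    ... | yes fN≤w = N , fN≤w , w<f1+N
    ... | no fN≰w = go s≤′N fs≤w (≰⇒> fN≰w)

iter-inflationary : ∀ {f : ℕ → ℕ} → (∀ x → x < f x) → ∀ j x → x ≤ iter f j x
iter-inflationary x<fx zero x = ≤-refl
iter-inflationary x<fx (suc j) x = ≤-trans (iter-inflationary x<fx j x) (<⇒≤ (x<fx _))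

iter-strict : ∀ {f : ℕ → ℕ} → (∀ x → x < f x) → ∀ {j} → 0 < j → ∀ x → x < iter f j x
iter-strict x<fx {suc j} _ x = ≤-<-trans (iter-inflationary x<fx j x) (x<fx _)

iter-unfold : ∀ (f : ℕ → ℕ) {j} → 0 < j → ∀ x → iter f j x ≡ f (iter f (pred j) x)
iter-unfold f {suc j} _ x = refl

_[_]≔_ : (ℕ → ℕ) → ℕ → ℕ → ℕ → ℕ
(f [ p ]≔ v) i with i ≟ p
... | yes _ = v
... | no _ = f i

[]≔-updates : ∀ f p v → (f [ p ]≔ v) p ≡ v
[]≔-updates f p v with p ≟ p
... | yes _ = refl
... | no p≢p = ⊥-elim (p≢p refl)

[]≔-minimal : ∀ f {p} v {i} → i ≢ p → (f [ p ]≔ v) i ≡ f i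
[]≔-minimal f {p} v {i} i≢p with i ≟ p
... | yes i≡p = ⊥-elim (i≢p i≡p)
... | no _ = refl

InWindow : ℕ → ℕ → ℕ → ℕ → Set
InWindow k a b w = Ack k a b ≤ w × w < Ack k a (suc b)

-- The i-th clause of IsSandwiching with x = m_i, a = a_{i+1}, b = b_{i+1}, y = m_{i+1};
-- a record rather than a product so that these indices can be inferred.
record Step (k w x a b y : ℕ) : Set where
  constructor step
  field
    index-bracket : Ack k a x ≤ w × w < Ack k (suc a) x
    window        : InWindow k a b w
    value         : y ≡ Ack k a b

record Steps (k w p : ℕ) (as bs ms : ℕ → ℕ) : Set where
  constructor steps
  field
    step-at : ∀ i → i < p → Step k w (ms i) (as (suc i)) (bs (suc i)) (ms (suc i))

open Steps

IsSandwiching⇒Steps : ∀ {k w n as bs ms} → IsSandwiching k w n as bs ms → Steps k w n as bs ms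
IsSandwiching⇒Steps (_ , _ , clauses , _) = steps λ i i<n →
  let bracket , window , value = clauses i i<n in step bracket window value

Steps⇒IsSandwiching : ∀ {k w n as bs ms} → 1 ≤ n → ms 0 ≡ 0 → Steps k w n as bs ms →
  Ack k 0 (ms n) > w → IsSandwiching k w n as bs ms
Steps⇒IsSandwiching 1≤n m₀ st end = 1≤n , m₀ , clauses , end
  where
    clauses = λ i i<n → let step bracket window value = step-at st i i<n in bracket , window , value

SamePairs : ℕ → (ℕ → ℕ) → (ℕ → ℕ) → (ℕ → ℕ) → (ℕ → ℕ) → Set
SamePairs p as bs as′ bs′ = ∀ i → 1 ≤ i → i ≤ p → as′ i ≡ as i × bs′ i ≡ bs i

SamePairs-[]≔ : ∀ {p as bs as′ bs′ a b} →
  SamePairs (suc p) (as [ suc p ]≔ a) (bs [ suc p ]≔ b) as′ bs′ → SamePairs p as bs as′ bs′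
SamePairs-[]≔ {as = as} {bs} {a = a} {b} same i 1≤i i≤p with same i 1≤i (m≤n⇒m≤1+n i≤p)
... | ea , eb = trans ea ([]≔-minimal as a (<⇒≢ (s≤s i≤p))) ,
                trans eb ([]≔-minimal bs b (<⇒≢ (s≤s i≤p)))

HasSandwichingExtending : ℕ → ℕ → ℕ → (ℕ → ℕ) → (ℕ → ℕ) → Set
HasSandwichingExtending k w p as bs =
  Σ ℕ λ n′ → Σ (ℕ → ℕ) λ as′ → Σ (ℕ → ℕ) λ bs′ → Σ (ℕ → ℕ) λ ms′ →
    IsSandwiching k w n′ as′ bs′ ms′ × p ≤ n′ × SamePairs p as bs as′ bs′

module AckermannProperties (k : ℕ) (1<k : 1 < k) where

  0<k : 0 < k
  0<k = <-trans (s≤s z≤n) 1<k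

  0<pred-k : 0 < pred k
  0<pred-k = pred-mono-≤ 1<k

  n<k^n : ∀ n → n < k ^ n
  n<k^n zero = s≤s z≤n
  n<k^n (suc n) = ≤-<-trans (n<k^n n) (^-monoʳ-< k 1<k (n<1+n n))

  n<Ack : ∀ a n → n < Ack k a n
  Ack-stepʳ : ∀ a n → Ack k a n < Ack k a (suc n)
  n<Ack zero n = n<k^n n
  n<Ack (suc a) zero = iter-inflationary (n<Ack a) k 1
  n<Ack (suc a) (suc n) = ≤-<-trans (n<Ack (suc a) n) (Ack-stepʳ (suc a) n)
  Ack-stepʳ zero n = ^-monoʳ-< k 1<k (n<1+n n)
  Ack-stepʳ (suc a) n = iter-strict (n<Ack a) 0<k (Ack k (suc a) n)

  Ack-monoʳ-< : ∀ a → Monotonic₁ _<_ _<_ (Ack k a)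
  Ack-monoʳ-< a = step⇒mono-< (Ack k a) (Ack-stepʳ a)

  Ack-monoʳ-≤ : ∀ a → Monotonic₁ _≤_ _≤_ (Ack k a)
  Ack-monoʳ-≤ a = step⇒mono-≤ (Ack k a) (λ n → <⇒≤ (Ack-stepʳ a n))

  Ack-suc-as-Ack : ∀ a n → ∃[ z ] n < z × Ack k (suc a) n ≡ Ack k a z
  Ack-suc-as-Ack a zero =
    _ , iter-inflationary (n<Ack a) (pred k) 1 , iter-unfold (Ack k a) 0<k 1
  Ack-suc-as-Ack a (suc n) =
    _ , ≤-<-trans (n<Ack (suc a) n) (iter-strict (n<Ack a) 0<pred-k _) ,
    iter-unfold (Ack k a) 0<k (Ack k (suc a) n)

  Ack-as-lower-Ack : ∀ {a′ a} → a′ < a → ∀ n → ∃[ z ] Ack k a n ≡ Ack k a′ z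
  Ack-as-lower-Ack a′<a = go (≤⇒≤′ a′<a)
    where
      go : ∀ {a′ a} → suc a′ ≤′ a → ∀ n → ∃[ z ] Ack k a n ≡ Ack k a′ z
      go ≤′-refl n with Ack-suc-as-Ack _ n
      ... | z , _ , eq = z , eq
      go (≤′-step a′<′a) n with Ack-suc-as-Ack _ n
      ... | z , _ , eq with go a′<′a z
      ...   | z′ , eq′ = z′ , trans eq eq′

  Ack-stepˡ : ∀ a n → Ack k a n < Ack k (suc a) n
  Ack-stepˡ a n with Ack-suc-as-Ack a n
  ... | z , n<z , eq rewrite eq = Ack-monoʳ-< a n<z

  Ack-monoˡ-≤ : ∀ n → Monotonic₁ _≤_ _≤_ (λ a → Ack k a n)
  Ack-monoˡ-≤ n = step⇒mono-≤ (λ a → Ack k a n) (λ a → <⇒≤ (Ack-stepˡ a n))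

  a≤Ack : ∀ a n → a ≤ Ack k a n
  a≤Ack zero n = z≤n
  a≤Ack (suc a) n = ≤-<-trans (a≤Ack a n) (Ack-stepˡ a n)

  Ack-window-≤ : ∀ a b z {w} → Ack k a b ≤ w → w < Ack k a z → Ack k a (suc b) ≤ Ack k a z
  Ack-window-≤ a b z l u =
    Ack-monoʳ-≤ a (mono-≤-reflects-< (Ack k a) (Ack-monoʳ-≤ a) (≤-<-trans l u))

  private variable
    m w x y z a a′ b b′ y′ n n′ p p′ : ℕ
    as bs ms as′ bs′ ms′ : ℕ → ℕ

  Step-start≤arg : Step k w x a b y → x ≤ b
  Step-start≤arg {a = a} (step (l , _) (_ , u) _) =
    s≤s⁻¹ (mono-≤-reflects-< (Ack k a) (Ack-monoʳ-≤ a) (≤-<-trans l u))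

  Step-increasing : Step k w x a b y → x < y
  Step-increasing {a = a} {b} s@(step _ _ refl) = ≤-<-trans (Step-start≤arg s) (n<Ack a b)

  Step⇒Ack₀≤ : Step k w x a b y → Ack k 0 x ≤ w
  Step⇒Ack₀≤ {x = x} {a} (step (l , _) _ _) = ≤-trans (Ack-monoˡ-≤ x {0} {a} z≤n) l

  Step-deterministic : Step k w x a b y → Step k w x a′ b′ y′ → a ≡ a′ × b ≡ b′ × y ≡ y′
  Step-deterministic {x = x} {a} {b} {a′ = a′} {b′}
                     (step (l , u) (lb , ub) e) (step (l′ , u′) (lb′ , ub′) e′)
    with bracket-unique (λ a → Ack k a x) (Ack-monoˡ-≤ x) a a′ l u l′ u′
  ... | refl with bracket-unique (Ack k a) (Ack-monoʳ-≤ a) b b′ lb ub lb′ ub′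
  ...   | refl = refl , refl , trans e (sym e′)

  Step-exists : Ack k 0 x ≤ w → ∃[ a ] ∃[ b ] Step k w x a b (Ack k a b)
  Step-exists {x} {w} A₀≤w
    with bracket-exists (λ a → Ack k a x) {0} {suc w} z≤n A₀≤w (a≤Ack (suc w) x)
  ... | a , la , ua
    with bracket-exists (Ack k a) {x} {suc w} x≤1+w la (<-trans (n<1+n w) (n<Ack a (suc w)))
    where x≤1+w = ≤-trans (<⇒≤ (n<Ack a x)) (m≤n⇒m≤1+n la)
  ...   | b , lb , ub = a , b , step (la , ua) (lb , ub) refl

  Step-transfer : Step k m x a b y → InWindow k a b w → Step k w x a b y
  Step-transfer {m} {x} {a} {b} s@(step (_ , u₀) (l , _) e) (l′ , u′) =
    step (≤-trans (Ack-monoʳ-≤ a (Step-start≤arg s)) l′ , <-≤-trans u′ top≤) (l′ , u′) e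
    where
      top≤ : Ack k a (suc b) ≤ Ack k (suc a) x
      top≤ with Ack-suc-as-Ack a x
      ... | z , _ , eq =
        subst (Ack k a (suc b) ≤_) (sym eq) (Ack-window-≤ a b z l (subst (m <_) eq u₀))

  Step-nested : Step k m x a b y → Step k m y a′ b′ z → InWindow k a′ b′ w → InWindow k a b w
  Step-nested {m} {x} {a} {b} {a′ = a′} {b′}
              (step _ (_ , u) refl) s′@(step (l₀′ , _) (l′ , _) _) (lw , uw) =
    ≤-trans (Step-start≤arg s′) (≤-trans (<⇒≤ (n<Ack a′ b′)) lw) , <-≤-trans uw top≤
    where
      a′<a : a′ < a
      a′<a = ≰⇒> λ a≤a′ → <⇒≱ u (begin
        Ack k a (suc b)        ≤⟨ Ack-monoʳ-≤ a (n<Ack a b) ⟩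
        Ack k a (Ack k a b)    ≤⟨ Ack-monoˡ-≤ (Ack k a b) a≤a′ ⟩
        Ack k a′ (Ack k a b)   ≤⟨ l₀′ ⟩
        m                      ∎)
        where open ≤-Reasoning
      top≤ : Ack k a′ (suc b′) ≤ Ack k a (suc b)
      top≤ with Ack-as-lower-Ack a′<a (suc b)
      ... | z , eq =
        subst (Ack k a′ (suc b′) ≤_) (sym eq) (Ack-window-≤ a′ b′ z l′ (subst (m <_) eq u))

  Steps-window-descends : Steps k m n as bs ms → ∀ {i j} → i ≤′ j → suc j ≤ n →
    InWindow k (as (suc j)) (bs (suc j)) w → InWindow k (as (suc i)) (bs (suc i)) w
  Steps-window-descends st ≤′-refl _ inW = inW
  Steps-window-descends st (≤′-step {j} i≤′j) 2+j≤n inW =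
    Steps-window-descends st i≤′j (<⇒≤ 2+j≤n)
      (Step-nested (step-at st j (<⇒≤ 2+j≤n)) (step-at st (suc j) 2+j≤n) inW)

  Steps-transfer : Steps k m n as bs ms → ∀ {j} → suc j ≤ n →
    InWindow k (as (suc j)) (bs (suc j)) w → Steps k w (suc j) as bs ms
  Steps-transfer st 1+j≤n inW = steps λ i i<1+j →
    Step-transfer (step-at st i (<-≤-trans i<1+j 1+j≤n))
                  (Steps-window-descends st (≤⇒≤′ (s≤s⁻¹ i<1+j)) 1+j≤n inW)

  Steps-agree : Steps k w p as bs ms → Steps k w p′ as′ bs′ ms′ → ms 0 ≡ ms′ 0 →
    ∀ i → i ≤ p → i ≤ p′ → ms i ≡ ms′ i
  Steps-agree st st′ e₀ zero _ _ = e₀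
  Steps-agree {w = w} {ms′ = ms′} st st′ e₀ (suc i) i<p i<p′ =
    let eᵢ = Steps-agree st st′ e₀ i (<⇒≤ i<p) (<⇒≤ i<p′)
        stepᵢ′ = subst (λ v → Step k w v _ _ (ms′ (suc i))) (sym eᵢ) (step-at st′ i i<p′)
        _ , _ , e = Step-deterministic (step-at st i i<p) stepᵢ′
    in e

  Steps-prefix-of-sandwiching : Steps k w p as bs ms → ms 0 ≡ 0 →
    IsSandwiching k w n′ as′ bs′ ms′ → p ≤ n′ × SamePairs p as bs as′ bs′
  Steps-prefix-of-sandwiching {w} {p} {as} {bs} {ms} {n′} {as′} {bs′} {ms′}
                              st m₀ sw@(_ , m₀′ , _ , end′) = p≤n′ , same
    where
      st′ : Steps k w n′ as′ bs′ ms′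
      st′ = IsSandwiching⇒Steps sw
      agree : ∀ i → i ≤ p → i ≤ n′ → ms i ≡ ms′ i
      agree = Steps-agree st st′ (trans m₀ (sym m₀′))
      p≤n′ : p ≤ n′
      p≤n′ = ≮⇒≥ λ n′<p → <⇒≱ end′
        (subst (λ v → Ack k 0 v ≤ w) (agree n′ (<⇒≤ n′<p) ≤-refl)
               (Step⇒Ack₀≤ (step-at st n′ n′<p)))
      same : SamePairs p as bs as′ bs′
      same (suc i) _ 1+i≤p =
        let eᵢ = agree i (<⇒≤ 1+i≤p) (≤-trans (<⇒≤ 1+i≤p) p≤n′)
            stepᵢ′ = subst (λ v → Step k w v _ _ (ms′ (suc i))) (sym eᵢ)
                           (step-at st′ i (<-≤-trans 1+i≤p p≤n′))
            ea , eb , _ = Step-deterministic stepᵢ′ (step-at st i 1+i≤p)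
        in ea , eb

  Steps-snoc : Steps k w p as bs ms → Step k w (ms p) a b y →
    Steps k w (suc p) (as [ suc p ]≔ a) (bs [ suc p ]≔ b) (ms [ suc p ]≔ y)
  Steps-snoc {w} {p} {as} {bs} {ms} {a} {b} {y} st s = steps last-or-earlier
    where
      last-or-earlier : ∀ i → i < suc p →
        Step k w ((ms [ suc p ]≔ y) i) ((as [ suc p ]≔ a) (suc i))
                 ((bs [ suc p ]≔ b) (suc i)) ((ms [ suc p ]≔ y) (suc i))
      last-or-earlier i i<1+p with m≤n⇒m<n∨m≡n (s≤s⁻¹ i<1+p)
      ... | inj₁ i<p
        rewrite []≔-minimal as a (<⇒≢ (s≤s i<p)) | []≔-minimal bs b (<⇒≢ (s≤s i<p))
              | []≔-minimal ms y (<⇒≢ (s≤s i<p)) | []≔-minimal ms y (<⇒≢ (m≤n⇒m≤1+n i<p))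
        = step-at st i i<p
      ... | inj₂ refl
        rewrite []≔-updates as (suc p) a | []≔-updates bs (suc p) b
              | []≔-updates ms (suc p) y | []≔-minimal ms y (<⇒≢ (n<1+n p)) = s

  -- Sandwiching values strictly increase, so fuel d with w < d + m_p suffices.
  Steps-extend : ∀ d → w < d + ms p → 1 ≤ p → ms 0 ≡ 0 → Steps k w p as bs ms →
    HasSandwichingExtending k w p as bs
  Steps-extend {w} {ms} {p} {as} {bs} d _ 1≤p m₀ st with Ack k 0 (ms p) ≤? w
  ... | no A₀≰w =
    p , as , bs , ms , Steps⇒IsSandwiching 1≤p m₀ st (≰⇒> A₀≰w) , ≤-refl ,
    λ _ _ _ → refl , refl
  Steps-extend {w} {ms} {p} zero w<mₚ _ _ _ | yes A₀≤w =
    ⊥-elim (<⇒≱ (<-trans w<mₚ (n<Ack 0 (ms p))) A₀≤w)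
  Steps-extend {w} {ms} {p} (suc d) w<fuel _ m₀ st | yes A₀≤w with Step-exists A₀≤w
  ... | a , b , s with Steps-extend d fuel′ (s≤s z≤n) m₀′ (Steps-snoc st s)
    where
      fuel′ : w < d + (ms [ suc p ]≔ Ack k a b) (suc p)
      fuel′ rewrite []≔-updates ms (suc p) (Ack k a b) =
        <-≤-trans w<fuel (≤-trans (≤-reflexive (sym (+-suc d (ms p))))
                                  (+-monoʳ-≤ d (Step-increasing s)))
      m₀′ : (ms [ suc p ]≔ Ack k a b) 0 ≡ 0
      m₀′ = trans ([]≔-minimal ms {suc p} (Ack k a b) λ ()) m₀
  ...   | n′ , as′ , bs′ , ms′ , sw , 1+p≤n′ , same =
    n′ , as′ , bs′ , ms′ , sw , <⇒≤ 1+p≤n′ , SamePairs-[]≔ same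

proposition3p3 : (k m n : ℕ) (as bs ms : ℕ → ℕ) (w j : ℕ) →
    2 ≤ k → 0 < m → IsSandwiching k m n as bs ms →
    1 ≤ j → j ≤ n →
    Ack k (as j) (bs j) ≤ w → w < Ack k (as j) (suc (bs j)) →
    -- (i) (as i , bs i)_{i=1}^j is an initial segment of the k-sandwiching sequence of w:
    --     some sandwiching sequence of w has it as prefix, and every one does
    ((Σ ℕ λ n′ → Σ (ℕ → ℕ) λ as′ → Σ (ℕ → ℕ) λ bs′ → Σ (ℕ → ℕ) λ ms′ →
        IsSandwiching k w n′ as′ bs′ ms′ × j ≤ n′ ×
        (∀ i → 1 ≤ i → i ≤ j → as′ i ≡ as i × bs′ i ≡ bs i)) ×
     (∀ n′ as′ bs′ ms′ → IsSandwiching k w n′ as′ bs′ ms′ →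
        j ≤ n′ × (∀ i → 1 ≤ i → i ≤ j → as′ i ≡ as i × bs′ i ≡ bs i))) ×
    -- (ii) if moreover A_0 m_j > w, it is the full sandwiching sequence of w,
    --      and w ≡_k A_{a_j} b_j + c for some c
    (Ack k 0 (ms j) > w →
       IsSandwiching k w j as bs ms × Σ ℕ λ c → NormalForm k w (as j) (bs j) c)
proposition3p3 k m n as bs ms w (suc j) 2≤k _ sw@(_ , m₀ , _ , _) 1≤j j≤n l u =
  (Steps-extend (suc w) (m≤m+n (suc w) (ms (suc j))) 1≤j m₀ stw ,
   λ _ _ _ _ → Steps-prefix-of-sandwiching stw m₀) ,
  λ w<A₀ → let sww = Steps⇒IsSandwiching 1≤j m₀ stw w<A₀ in
    sww , (w ∸ Ack k (as (suc j)) (bs (suc j))) , sym (m+[n∸m]≡n l) ,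
    suc j , as , bs , ms , sww , refl , refl
  where
    open AckermannProperties k 2≤k
    stw : Steps k w (suc j) as bs ms
    stw = Steps-transfer (IsSandwiching⇒Steps sw) j≤n (l , u)
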